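{- Let $n\ge1$. For every $x\in\mathbb{D}_n$ and every $\sigma\in\mathrm{Sym}(n+1)$, $$\alpha''_n(\sigma,x)=\iota\big(\alpha_n(\sigma,\iota^{ -1}(x))\big).$$
   Context: $\mathbb{N}^*=\mathbb{N}\setminus\{0\}$. $\mathrm{Sym}(n+1)$ is the group of bijections of $\{1,\dots,n+1\}$ with product $\sigma\cdot\rho:=\rho\circ\sigma$; $(i\ j)$ is a transposition, $(n+1\ n+1)=\mathrm{id}$. Signs: $\mathbb{B}=\{+,-\}$ is the two-element group, identified with $\mathbb{Z}/2\mathbb{Z}$ via $+\leftrightarrow0$, $-\leftrightarrow1$ (so the product of signs is addition mod 2; $-x$ means $(-)\cdot x$); $\forall,\exists$ denote $+,-$. $\delta_{i,j}\in\mathbb{Z}/2\mathbb{Z}$ is the Kronecker delta. (1) $\mathbb{C}_n=\mathrm{Sym}(n+1)\times\mathbb{B}\times\mathbb{B}\times(\mathbb{N}^*)^{n+1}\times\mathbb{B}^n$, elements $(\sigma,\pm,\text{\AE},(k_1,\dots,k_{n+1}),(\pm_1,\dots,\pm_n))$. $\alpha_n(\rho,(\sigma,\pm,\text{\AE},k,(\pm_i)))$ is: if $\rho(n+1)=n+1$, $(\rho\cdot\sigma,\pm,\text{\AE},(k_{\rho(1)},\dots,k_{\rho(n+1)}),(\pm_{\rho(1)},\dots,\pm_{\rho(n)}))$; if $\rho(n+1)\ne n+1$, with $\tau=(n+1\ \rho(n+1))$, $m=\rho^{ -1}(n+1)$: $(\rho\cdot\sigma,-\pm_{\rho(n+1)}\pm,-\pm_{\rho(n+1)}\text{\AE},(k_{\rho(1)},\dots,k_{\rho(n+1)}),(t_1,\dots,t_n))$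 with $t_m=\pm_{\tau(\rho(m))}$ and $t_i=-\pm_{\rho(n+1)}\pm_{\tau(\rho(i))}$ for $i\ne m$. (2) $\mathbb{D}_n=\mathrm{Sym}(n+1)\times(\mathbb{N}^*)^{n+1}\times(\mathbb{Z}/2\mathbb{Z})^{n+1}\times\mathbb{Z}/2\mathbb{Z}$. $Q(\sigma)$ is the matrix $Q(\sigma)_{i,j}=\delta_{(n+1\ \sigma(n+1))(\sigma(i)),\,j}+\delta_{\sigma(n+1),j}(1+\delta_{n+1,\sigma(i)})(1+\delta_{\sigma(n+1),n+1})$ acting on column vectors; $R(\sigma,v)=d^\sigma+Q(\sigma)v$ with $d^\sigma_j=(1+\delta_{n+1,\sigma(j)})(1+\delta_{n+1,\sigma(n+1)})$; $P_{\mathbb{N}^*}(\sigma)(k_1,\dots,k_{n+1})=(k_{\sigma(1)},\dots,k_{\sigma(n+1)})$; $\alpha''_n(\sigma,(\sigma',k,v,s))=(\sigma\cdot\sigma',P_{\mathbb{N}^*}(\sigma)(k),R(\sigma,v),s)$. (3) The translations are $\iota:\mathbb{C}_n\to\mathbb{D}_n$, $\iota(\sigma,\pm,\text{\AE},k,(\pm_1,\dots,\pm_n))=(\sigma,k,(\pm_1,\dots,\pm_n,\pm),\pm+\text{\AE})$, and its inverse $\iota^{ -1}(\sigma,k,(\pm_1,\dots,\pm_{n+1}),s)=(\sigma,\pm_{n+1},\pm_{n+1}+s,k,(\pm_1,\dots,\pm_n))$. -}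

module Defs where

open import Data.Nat using (ℕ; zero; suc; NonZero)
open import Data.Bool using (Bool; true; false; not; _xor_; _∧_; if_then_else_)
open import Data.Fin using (Fin; fromℕ; inject₁; zero; suc)
open import Data.Fin.Properties using (_≟_)
open import Data.Fin.Permutation using (Permutation′; _⟨$⟩ʳ_; _⟨$⟩ˡ_; _∘ₚ_; transpose)
open import Data.Vec using (Vec; []; _∷_; lookup; tabulate; _∷ʳ_; init; last)
open import Data.Product using (Σ; _×_; _,_)
open import Relation.Nullary.Decidable using (⌊_⌋; yes; no)

-- Sym(n+1): permutations of Fin (suc n); index i ∈ {1..n+1} is Fin (suc n), n+1 ↔ fromℕ n.
Sym : ℕ → Set
Sym n = Permutation′ (suc n)

-- the paper's product σ·ρ := ρ ∘ σ ; stdlib: (σ ∘ₚ ρ) ⟨$⟩ʳ i = ρ ⟨$⟩ʳ (σ ⟨$⟩ʳ i)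
_·_ : ∀ {n} → Sym n → Sym n → Sym n
σ · ρ = σ ∘ₚ ρ

top : ∀ n → Fin (suc n)
top n = fromℕ n

ℕ* : Set
ℕ* = Σ ℕ NonZero

-- Signs 𝔹 = {+,-} identified with ℤ/2ℤ: + ↔ false (0), - ↔ true (1).
-- Product of signs = addition mod 2 = xor.
𝔹 : Set
𝔹 = Bool

ℤ₂ : Set
ℤ₂ = Bool

plus minus : 𝔹
plus = false
minus = true

δ : ∀ {m} → Fin m → Fin m → ℤ₂
δ i j = ⌊ i ≟ j ⌋

Σ₂ : ∀ {m} → (Fin m → ℤ₂) → ℤ₂
Σ₂ {zero} f = false
Σ₂ {suc m} f = f zero xor Σ₂ (λ i → f (suc i))

ℂ : ℕ → Set
ℂ n = Sym n × 𝔹 × 𝔹 × Vec ℕ* (suc n) × Vec 𝔹 n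

𝔻 : ℕ → Set
𝔻 n = Sym n × Vec ℕ* (suc n) × Vec ℤ₂ (suc n) × ℤ₂

-- ±_j for j ∈ {1..n+1} read from a vector (±_1,…,±_n); the value at index n+1
-- is a totalisation default (never used by α_n).
sgn : ∀ {n} → Vec 𝔹 n → Fin (suc n) → 𝔹
sgn v j = lookup (v ∷ʳ plus) j

permVec : ∀ {n} {A : Set} → Sym n → Vec A (suc n) → Vec A (suc n)
permVec ρ k = tabulate (λ i → lookup k (ρ ⟨$⟩ʳ i))

α : ∀ n → Sym n → ℂ n → ℂ n
α n ρ (σ , s , æ , k , v) with ρ ⟨$⟩ʳ top n ≟ top n
... | yes _ = (ρ · σ , s , æ , permVec ρ k , tabulate (λ i → sgn v (ρ ⟨$⟩ʳ inject₁ i)))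
... | no _ = (ρ · σ , (e xor s) , (e xor æ) , permVec ρ k , tabulate t)
  where
    τ : Sym n
    τ = transpose (top n) (ρ ⟨$⟩ʳ top n)
    m : Fin (suc n)
    m = ρ ⟨$⟩ˡ top n
    e : 𝔹
    e = minus xor sgn v (ρ ⟨$⟩ʳ top n)
    t : Fin n → 𝔹
    t i with inject₁ i ≟ m
    ... | yes _ = sgn v (τ ⟨$⟩ʳ (ρ ⟨$⟩ʳ inject₁ i))
    ... | no _ = e xor sgn v (τ ⟨$⟩ʳ (ρ ⟨$⟩ʳ inject₁ i))

Q : ∀ n → Sym n → Fin (suc n) → Fin (suc n) → ℤ₂
Q n σ i j =
  δ (τ ⟨$⟩ʳ (σ ⟨$⟩ʳ i)) j
  xor (δ (σ ⟨$⟩ʳ top n) j ∧ (not (δ (top n) (σ ⟨$⟩ʳ i)) ∧ not (δ (σ ⟨$⟩ʳ top n) (top n))))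
  where
    τ : Sym n
    τ = transpose (top n) (σ ⟨$⟩ʳ top n)

d : ∀ n → Sym n → Fin (suc n) → ℤ₂
d n σ j = not (δ (top n) (σ ⟨$⟩ʳ j)) ∧ not (δ (top n) (σ ⟨$⟩ʳ top n))

R : ∀ n → Sym n → Vec ℤ₂ (suc n) → Vec ℤ₂ (suc n)
R n σ v = tabulate (λ i → d n σ i xor Σ₂ (λ j → Q n σ i j ∧ lookup v j))

α'' : ∀ n → Sym n → 𝔻 n → 𝔻 n
α'' n σ (σ' , k , v , s) = (σ · σ' , permVec σ k , R n σ v , s)

ι : ∀ n → ℂ n → 𝔻 n
ι n (σ , s , æ , k , v) = (σ , k , v ∷ʳ s , s xor æ)

ι⁻¹ : ∀ n → 𝔻 n → ℂ n
ι⁻¹ n (σ , k , v , s) = (σ , last v , last v xor s , k , init v)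

{-# OPTIONS --safe #-}
module Submission where

-- Both actions treat the permutation and the (ℕ*)^{n+1} coordinates alike, and ι⁻¹ reads ± off
-- the last sign coordinate y of x, so everything comes down to the sign vector R(σ, ys ∷ʳ y).
-- Row i of Q(σ) has a 1 at τσ(i), and a second 1 at σ(n+1) exactly when d^σ_i = 1, i.e. when
-- neither σ(i) nor σ(n+1) is n+1. Hence R(σ,v)_i is v_{τσ(i)} if d^σ_i = 0 and
-- (1 + v_{σ(n+1)}) + v_{τσ(i)} otherwise. This is the sign rule of α_n: the flip 1 + v_{σ(n+1)}
-- is −±_{σ(n+1)}, withheld exactly at i = σ⁻¹(n+1) (the index m of α_n), and τ does nothing when
-- σ fixes n+1. The scalar coordinate survives because (e + y) + (e + (y + s)) = s.

open import Defs
open import Data.Nat using (ℕ; _≤_; zero; suc)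
open import Data.Bool using (true; false; not; _xor_; _∧_)
open import Data.Bool.Properties
  using (xor-identityʳ; xor-comm; xor-annihilates-not; not-involutive; not-distribˡ-xor;
         ∧-distribʳ-xor; ∧-assoc; ∧-zeroʳ; xor-∧-commutativeRing)
open import Algebra.Bundles using (CommutativeRing)
open import Algebra.Properties.CommutativeSemigroup
  (CommutativeRing.+-commutativeSemigroup xor-∧-commutativeRing) using (interchange)
open import Data.Fin using (Fin; zero; suc; fromℕ; inject₁)
open import Data.Fin.Properties using (_≟_; fromℕ≢inject₁)
open import Data.Fin.Permutation
  using (Permutation′; _⟨$⟩ʳ_; _⟨$⟩ˡ_; inverseˡ; inverseʳ; transpose)
open import Data.Vec using (Vec; []; _∷_; lookup; tabulate; _∷ʳ_; init; last; initLast)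
open import Data.Vec.Properties using (tabulate-cong; lookup∘tabulate)
open import Data.Product using (_,_; proj₂)
open import Data.Sum using ([_,_]′)
open import Function using (_∘_)
open import Function.Bundles using (Injection)
open import Function.Properties.Inverse using (↔⇒↣)
open import Relation.Binary.PropositionalEquality
  using (_≡_; _≢_; _≗_; refl; sym; trans; cong; cong₂; module ≡-Reasoning)
open import Relation.Nullary using (yes; no; contradiction)
open import Relation.Nullary.Decidable using (dec-true; dec-false; isYes≗does; toSum)

open ≡-Reasoning

xor-cancelˡ : ∀ x y → x xor (x xor y) ≡ y
xor-cancelˡ false y = refl
xor-cancelˡ true  y = not-involutive y

xor-cancel-common : ∀ e x y → (e xor x) xor (e xor y) ≡ x xor y
xor-cancel-common false x y = refl
xor-cancel-common true  x y = xor-annihilates-not x y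

δ-≡ : ∀ {m} {a b : Fin m} → a ≡ b → δ a b ≡ true
δ-≡ {a = a} {b} a≡b = trans (isYes≗does (a ≟ b)) (dec-true (a ≟ b) a≡b)

δ-≢ : ∀ {m} {a b : Fin m} → a ≢ b → δ a b ≡ false
δ-≢ {a = a} {b} a≢b = trans (isYes≗does (a ≟ b)) (dec-false (a ≟ b) a≢b)

δ-sym : ∀ {m} (a b : Fin m) → δ a b ≡ δ b a
δ-sym a b with a ≟ b
... | yes a≡b = sym (δ-≡ (sym a≡b))
... | no  a≢b = sym (δ-≢ (a≢b ∘ sym))

δ-suc : ∀ {m} (a b : Fin m) → δ (suc a) (suc b) ≡ δ a b
δ-suc a b = trans (isYes≗does (suc a ≟ suc b)) (sym (isYes≗does (a ≟ b)))

Σ₂-cong : ∀ {m} {f g : Fin m → ℤ₂} → f ≗ g → Σ₂ f ≡ Σ₂ g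
Σ₂-cong {zero}  f≗g = refl
Σ₂-cong {suc m} f≗g = cong₂ _xor_ (f≗g zero) (Σ₂-cong (λ j → f≗g (suc j)))

Σ₂-zero : ∀ m → Σ₂ {m} (λ _ → false) ≡ false
Σ₂-zero zero    = refl
Σ₂-zero (suc m) = Σ₂-zero m

Σ₂-xor : ∀ {m} (f g : Fin m → ℤ₂) → Σ₂ (λ j → f j xor g j) ≡ Σ₂ f xor Σ₂ g
Σ₂-xor {zero}  f g = refl
Σ₂-xor {suc m} f g = begin
  (f zero xor g zero) xor Σ₂ (λ j → f (suc j) xor g (suc j))
    ≡⟨ cong ((f zero xor g zero) xor_) (Σ₂-xor (λ j → f (suc j)) (λ j → g (suc j))) ⟩
  (f zero xor g zero) xor (Σ₂ (λ j → f (suc j)) xor Σ₂ (λ j → g (suc j)))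
    ≡⟨ interchange (f zero) (g zero) _ _ ⟩
  Σ₂ f xor Σ₂ g ∎

Σ₂-δ : ∀ {m} (a : Fin m) (f : Fin m → ℤ₂) → Σ₂ (λ j → δ a j ∧ f j) ≡ f a
Σ₂-δ {suc m} zero    f = trans (cong (f zero xor_) (Σ₂-zero m)) (xor-identityʳ (f zero))
Σ₂-δ {suc m} (suc a) f =
  trans (Σ₂-cong (λ j → cong (_∧ f (suc j)) (δ-suc a j))) (Σ₂-δ a (λ j → f (suc j)))

Σ₂-δ-xor-δ : ∀ {m} (a b : Fin m) (c : ℤ₂) (f : Fin m → ℤ₂) →
  Σ₂ (λ j → (δ a j xor (δ b j ∧ c)) ∧ f j) ≡ f a xor (c ∧ f b)
Σ₂-δ-xor-δ a b c f = begin
  Σ₂ (λ j → (δ a j xor (δ b j ∧ c)) ∧ f j)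
    ≡⟨ Σ₂-cong distrib ⟩
  Σ₂ (λ j → (δ a j ∧ f j) xor (δ b j ∧ (c ∧ f j)))
    ≡⟨ Σ₂-xor (λ j → δ a j ∧ f j) (λ j → δ b j ∧ (c ∧ f j)) ⟩
  Σ₂ (λ j → δ a j ∧ f j) xor Σ₂ (λ j → δ b j ∧ (c ∧ f j))
    ≡⟨ cong₂ _xor_ (Σ₂-δ a f) (Σ₂-δ b (λ j → c ∧ f j)) ⟩
  f a xor (c ∧ f b) ∎
  where
  distrib : ∀ j → (δ a j xor (δ b j ∧ c)) ∧ f j ≡ (δ a j ∧ f j) xor (δ b j ∧ (c ∧ f j))
  distrib j = trans (∧-distribʳ-xor (f j) (δ a j) (δ b j ∧ c))
                    (cong ((δ a j ∧ f j) xor_) (∧-assoc (δ b j) c (f j)))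

lookup-∷ʳ-fromℕ : ∀ {n} {A : Set} (xs : Vec A n) (x : A) → lookup (xs ∷ʳ x) (fromℕ n) ≡ x
lookup-∷ʳ-fromℕ []       x = refl
lookup-∷ʳ-fromℕ (_ ∷ xs) x = lookup-∷ʳ-fromℕ xs x

lookup-∷ʳ-≢fromℕ : ∀ {n} {A : Set} (xs : Vec A n) {x y : A} (a : Fin (suc n)) → a ≢ fromℕ n →
  lookup (xs ∷ʳ x) a ≡ lookup (xs ∷ʳ y) a
lookup-∷ʳ-≢fromℕ []       zero    a≢n = contradiction refl a≢n
lookup-∷ʳ-≢fromℕ (_ ∷ xs) zero    a≢n = refl
lookup-∷ʳ-≢fromℕ (_ ∷ xs) (suc a) a≢n = lookup-∷ʳ-≢fromℕ xs a (a≢n ∘ cong suc)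

≡-tabulate-∷ʳ : ∀ {n} {A : Set} (w : Vec A (suc n)) {f : Fin n → A} {x : A} →
  (∀ j → lookup w (inject₁ j) ≡ f j) → lookup w (fromℕ n) ≡ x → w ≡ tabulate f ∷ʳ x
≡-tabulate-∷ʳ {zero}  (w ∷ []) _  last≡x = cong (_∷ []) last≡x
≡-tabulate-∷ʳ {suc n} (w ∷ ws) eq last≡x =
  cong₂ _∷_ (eq zero) (≡-tabulate-∷ʳ ws (λ j → eq (suc j)) last≡x)

transpose-matchˡ : ∀ {m} (i j : Fin m) → transpose i j ⟨$⟩ʳ i ≡ j
transpose-matchˡ i j rewrite dec-true (i ≟ i) refl = refl

transpose-matchʳ : ∀ {m} (i j : Fin m) → transpose i j ⟨$⟩ʳ j ≡ i
transpose-matchʳ i j with j ≟ i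
... | yes j≡i = j≡i
... | no  j≢i rewrite dec-true (j ≟ j) refl = refl

transpose-self : ∀ {m} (i k : Fin m) → transpose i i ⟨$⟩ʳ k ≡ k
transpose-self i k with k ≟ i
... | yes k≡i = sym k≡i
... | no  k≢i rewrite dec-false (k ≟ i) k≢i = refl

⟨$⟩ʳ-injective : ∀ {m} (π : Permutation′ m) {i j : Fin m} → π ⟨$⟩ʳ i ≡ π ⟨$⟩ʳ j → i ≡ j
⟨$⟩ʳ-injective π = Injection.injective (↔⇒↣ π)

module _ {n : ℕ} (σ : Sym n) where
  private
    p : Fin (suc n)
    p = σ ⟨$⟩ʳ top n

    τ : Sym n
    τ = transpose (top n) p

    τσ : Fin (suc n) → Fin (suc n)
    τσ i = τ ⟨$⟩ʳ (σ ⟨$⟩ʳ i)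

  lookup-R : ∀ v i → lookup (R n σ v) i ≡ d n σ i xor (lookup v (τσ i) xor (d n σ i ∧ lookup v p))
  lookup-R v i = begin
    lookup (R n σ v) i
      ≡⟨ lookup∘tabulate (λ i → d n σ i xor Σ₂ (λ j → Q n σ i j ∧ lookup v j)) i ⟩
    d n σ i xor Σ₂ (λ j → Q n σ i j ∧ lookup v j)
      ≡⟨ cong (d n σ i xor_) (Σ₂-δ-xor-δ (τσ i) p (c (δ p (top n))) (lookup v)) ⟩
    d n σ i xor (lookup v (τσ i) xor (c (δ p (top n)) ∧ lookup v p))
      ≡⟨ cong (λ b → d n σ i xor (lookup v (τσ i) xor (c b ∧ lookup v p))) (δ-sym p (top n)) ⟩
    d n σ i xor (lookup v (τσ i) xor (d n σ i ∧ lookup v p)) ∎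
    where
    c : ℤ₂ → ℤ₂
    c b = not (δ (top n) (σ ⟨$⟩ʳ i)) ∧ not b

  lookup-R-d≡false : ∀ v i → d n σ i ≡ false → lookup (R n σ v) i ≡ lookup v (τσ i)
  lookup-R-d≡false v i d≡false = begin
    lookup (R n σ v) i                                          ≡⟨ lookup-R v i ⟩
    d n σ i xor (lookup v (τσ i) xor (d n σ i ∧ lookup v p))
      ≡⟨ cong (λ b → b xor (lookup v (τσ i) xor (b ∧ lookup v p))) d≡false ⟩
    lookup v (τσ i) xor false                                   ≡⟨ xor-identityʳ _ ⟩
    lookup v (τσ i)                                             ∎

  lookup-R-d≡true : ∀ v i → d n σ i ≡ true →
    lookup (R n σ v) i ≡ (true xor lookup v p) xor lookup v (τσ i)
  lookup-R-d≡true v i d≡true = begin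
    lookup (R n σ v) i                                          ≡⟨ lookup-R v i ⟩
    d n σ i xor (lookup v (τσ i) xor (d n σ i ∧ lookup v p))
      ≡⟨ cong (λ b → b xor (lookup v (τσ i) xor (b ∧ lookup v p))) d≡true ⟩
    not (lookup v (τσ i) xor lookup v p)                        ≡⟨ cong not (xor-comm _ (lookup v p)) ⟩
    not (lookup v p xor lookup v (τσ i))                        ≡⟨ not-distribˡ-xor (lookup v p) _ ⟩
    (true xor lookup v p) xor lookup v (τσ i)                   ∎

  d-hit : ∀ i → σ ⟨$⟩ʳ i ≡ top n → d n σ i ≡ false
  d-hit i hit = cong (λ b → not b ∧ not (δ (top n) p)) (δ-≡ (sym hit))

  d-fixed : ∀ i → p ≡ top n → d n σ i ≡ false
  d-fixed i fixed =
    trans (cong (λ b → not (δ (top n) (σ ⟨$⟩ʳ i)) ∧ not b) (δ-≡ (sym fixed))) (∧-zeroʳ _)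

  d-moved : ∀ i → σ ⟨$⟩ʳ i ≢ top n → p ≢ top n → d n σ i ≡ true
  d-moved i miss moved = cong₂ (λ b b′ → not b ∧ not b′) (δ-≢ (miss ∘ sym)) (δ-≢ (moved ∘ sym))

  σ-inject₁≢p : ∀ j → σ ⟨$⟩ʳ inject₁ j ≢ p
  σ-inject₁≢p j eq = fromℕ≢inject₁ (sym (⟨$⟩ʳ-injective σ eq))

  signFlip : Vec 𝔹 n → 𝔹
  signFlip v = minus xor sgn v p

  movedSigns : Vec 𝔹 n → Fin n → 𝔹
  movedSigns v i with inject₁ i ≟ σ ⟨$⟩ˡ top n
  ... | yes _ = sgn v (τσ (inject₁ i))
  ... | no  _ = signFlip v xor sgn v (τσ (inject₁ i))

  R-fixed : p ≡ top n → ∀ ys y →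
    R n σ (ys ∷ʳ y) ≡ tabulate (λ i → sgn ys (σ ⟨$⟩ʳ inject₁ i)) ∷ʳ y
  R-fixed fixed ys y = ≡-tabulate-∷ʳ (R n σ V) entry last-entry
    where
    V : Vec 𝔹 (suc n)
    V = ys ∷ʳ y

    τσ≡σ : ∀ i → τσ i ≡ σ ⟨$⟩ʳ i
    τσ≡σ i = trans (cong (λ q → transpose (top n) q ⟨$⟩ʳ (σ ⟨$⟩ʳ i)) fixed)
                   (transpose-self (top n) (σ ⟨$⟩ʳ i))

    entry : ∀ j → lookup (R n σ V) (inject₁ j) ≡ sgn ys (σ ⟨$⟩ʳ inject₁ j)
    entry j = begin
      lookup (R n σ V) (inject₁ j)
        ≡⟨ lookup-R-d≡false V (inject₁ j) (d-fixed (inject₁ j) fixed) ⟩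
      lookup V (τσ (inject₁ j))
        ≡⟨ cong (lookup V) (τσ≡σ (inject₁ j)) ⟩
      lookup V (σ ⟨$⟩ʳ inject₁ j)
        ≡⟨ lookup-∷ʳ-≢fromℕ ys _ (λ eq → σ-inject₁≢p j (trans eq (sym fixed))) ⟩
      sgn ys (σ ⟨$⟩ʳ inject₁ j) ∎

    last-entry : lookup (R n σ V) (top n) ≡ y
    last-entry = begin
      lookup (R n σ V) (top n)  ≡⟨ lookup-R-d≡false V (top n) (d-fixed (top n) fixed) ⟩
      lookup V (τσ (top n))     ≡⟨ cong (lookup V) (trans (τσ≡σ (top n)) fixed) ⟩
      lookup V (top n)          ≡⟨ lookup-∷ʳ-fromℕ ys y ⟩
      y                         ∎

  R-moved : p ≢ top n → ∀ ys y →
    R n σ (ys ∷ʳ y) ≡ tabulate (movedSigns ys) ∷ʳ (signFlip ys xor y)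
  R-moved moved ys y = ≡-tabulate-∷ʳ (R n σ V) entry last-entry
    where
    V : Vec 𝔹 (suc n)
    V = ys ∷ʳ y

    V≡sgn : ∀ a → a ≢ top n → lookup V a ≡ sgn ys a
    V≡sgn = lookup-∷ʳ-≢fromℕ ys

    τp≡top : τ ⟨$⟩ʳ p ≡ top n
    τp≡top = transpose-matchʳ (top n) p

    entry : ∀ j → lookup (R n σ V) (inject₁ j) ≡ movedSigns ys j
    entry j with inject₁ j ≟ σ ⟨$⟩ˡ top n
    ... | yes hit = begin
      lookup (R n σ V) (inject₁ j)  ≡⟨ lookup-R-d≡false V (inject₁ j) (d-hit (inject₁ j) σi≡top) ⟩
      lookup V (τσ (inject₁ j))     ≡⟨ V≡sgn _ (λ eq → moved (trans (sym τσi≡p) eq)) ⟩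
      sgn ys (τσ (inject₁ j))       ∎
      where
      σi≡top : σ ⟨$⟩ʳ inject₁ j ≡ top n
      σi≡top = trans (cong (σ ⟨$⟩ʳ_) hit) (inverseʳ σ)

      τσi≡p : τσ (inject₁ j) ≡ p
      τσi≡p = trans (cong (τ ⟨$⟩ʳ_) σi≡top) (transpose-matchˡ (top n) p)
    ... | no miss = begin
      lookup (R n σ V) (inject₁ j)
        ≡⟨ lookup-R-d≡true V (inject₁ j) (d-moved (inject₁ j) σi≢top moved) ⟩
      (true xor lookup V p) xor lookup V (τσ (inject₁ j))
        ≡⟨ cong₂ (λ a b → (true xor a) xor b) (V≡sgn p moved) (V≡sgn _ τσi≢top) ⟩
      signFlip ys xor sgn ys (τσ (inject₁ j)) ∎
      where
      σi≢top : σ ⟨$⟩ʳ inject₁ j ≢ top n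
      σi≢top eq = miss (trans (sym (inverseˡ σ)) (cong (σ ⟨$⟩ˡ_) eq))

      τσi≢top : τσ (inject₁ j) ≢ top n
      τσi≢top eq = σ-inject₁≢p j (⟨$⟩ʳ-injective τ (trans eq (sym τp≡top)))

    last-entry : lookup (R n σ V) (top n) ≡ signFlip ys xor y
    last-entry = begin
      lookup (R n σ V) (top n)
        ≡⟨ lookup-R-d≡true V (top n) (d-moved (top n) moved moved) ⟩
      (true xor lookup V p) xor lookup V (τ ⟨$⟩ʳ p)
        ≡⟨ cong₂ (λ a b → (true xor a) xor b)
                 (V≡sgn p moved) (trans (cong (lookup V) τp≡top) (lookup-∷ʳ-fromℕ ys y)) ⟩
      signFlip ys xor y ∎

  α-fixed : p ≡ top n → ∀ σ′ s æ k v →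
    α n σ (σ′ , s , æ , k , v)
      ≡ (σ · σ′ , s , æ , permVec σ k , tabulate (λ i → sgn v (σ ⟨$⟩ʳ inject₁ i)))
  α-fixed fixed σ′ s æ k v with σ ⟨$⟩ʳ top n ≟ top n
  ... | yes _     = refl
  ... | no  moved = contradiction fixed moved

  -- The sign function of α is local to its definition and cannot be named: the left-hand
  -- side of this equation is inferred from its use in α-moved, which precedes its proof.
  movedSigns-agree : (moved : p ≢ top n) → ∀ σ′ s æ k v i → _ ≡ movedSigns v i

  α-moved : p ≢ top n → ∀ σ′ s æ k v →
    α n σ (σ′ , s , æ , k , v)
      ≡ (σ · σ′ , signFlip v xor s , signFlip v xor æ , permVec σ k , tabulate (movedSigns v))
  α-moved moved σ′ s æ k v with σ ⟨$⟩ʳ top n ≟ top n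
  ... | yes fixed  = contradiction fixed moved
  ... | no  moved′ = cong (λ w → (σ · σ′ , signFlip v xor s , signFlip v xor æ , permVec σ k , w))
                          (tabulate-cong (movedSigns-agree moved′ σ′ s æ k v))

  movedSigns-agree moved σ′ s æ k v i with inject₁ i ≟ σ ⟨$⟩ˡ top n
  ... | yes _ = refl
  ... | no  _ = refl

  α''-fixed : p ≡ top n → ∀ σ′ k ys y s →
    α'' n σ (σ′ , k , ys ∷ʳ y , s) ≡ ι n (α n σ (σ′ , y , y xor s , k , ys))
  α''-fixed fixed σ′ k ys y s = begin
    α'' n σ (σ′ , k , ys ∷ʳ y , s)
      ≡⟨ cong₂ (λ w t → (σ · σ′ , permVec σ k , w , t)) (R-fixed fixed ys y) (sym (xor-cancelˡ y s)) ⟩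
    ι n (σ · σ′ , y , y xor s , permVec σ k , tabulate (λ i → sgn ys (σ ⟨$⟩ʳ inject₁ i)))
      ≡⟨ cong (ι n) (sym (α-fixed fixed σ′ y (y xor s) k ys)) ⟩
    ι n (α n σ (σ′ , y , y xor s , k , ys)) ∎

  α''-moved : p ≢ top n → ∀ σ′ k ys y s →
    α'' n σ (σ′ , k , ys ∷ʳ y , s) ≡ ι n (α n σ (σ′ , y , y xor s , k , ys))
  α''-moved moved σ′ k ys y s = begin
    α'' n σ (σ′ , k , ys ∷ʳ y , s)
      ≡⟨ cong₂ (λ w t → (σ · σ′ , permVec σ k , w , t)) (R-moved moved ys y) (sym last≡s) ⟩
    ι n (σ · σ′ , e xor y , e xor (y xor s) , permVec σ k , tabulate (movedSigns ys))
      ≡⟨ cong (ι n) (sym (α-moved moved σ′ y (y xor s) k ys)) ⟩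
    ι n (α n σ (σ′ , y , y xor s , k , ys)) ∎
    where
    e : 𝔹
    e = signFlip ys

    last≡s : (e xor y) xor (e xor (y xor s)) ≡ s
    last≡s = trans (xor-cancel-common e y (y xor s)) (xor-cancelˡ y s)

  α''-∷ʳ : ∀ σ′ k ys y s → α'' n σ (σ′ , k , ys ∷ʳ y , s) ≡ ι n (α n σ (σ′ , y , y xor s , k , ys))
  α''-∷ʳ = [ α''-fixed , α''-moved ]′ (toSum (p ≟ top n))

-- The identity holds for n = 0 as well.
mainTheorem7 : (n : ℕ) → 1 ≤ n → (x : 𝔻 n) (σ : Sym n) →
    α'' n σ x ≡ ι n (α n σ (ι⁻¹ n x))
mainTheorem7 n _ (σ′ , k , v , s) σ = begin
  α'' n σ (σ′ , k , v , s)
    ≡⟨ cong (λ w → α'' n σ (σ′ , k , w , s)) (proj₂ (proj₂ (initLast v))) ⟩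
  α'' n σ (σ′ , k , init v ∷ʳ last v , s)
    ≡⟨ α''-∷ʳ σ σ′ k (init v) (last v) s ⟩
  ι n (α n σ (ι⁻¹ n (σ′ , k , v , s))) ∎
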